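{- Let $k\geq 2$ be an integer, let $r_0=\lceil\sqrt{2k}\,\rceil$, $\ell_0=\left\lceil \frac{k-1}{\lceil\sqrt{2k}\,\rceil}\right\rceil+2$, and $f(k)=\ell_0^2 r_0$. Then for every integer $n\geq f(k)$, $rc_k(K_n)=2$, where $K_n$ is the complete graph on $n$ vertices.
   Context: In an edge-colored graph (adjacent edges may receive the same color), a path is rainbow if no two of its edges have the same color. For a $\kappa$-connected graph $G$ and an integer $k$ with $1\leq k\leq\kappa$, the rainbow $k$-connectivity $rc_k(G)$ is the minimum integer $j$ such that there is an edge-coloring of $G$ with $j$ colors in which every two distinct vertices $u,v$ are connected by at least $k$ internally disjoint rainbow $u$–$v$ paths. -}

module Defs where

open import Data.Nat using (ℕ; zero; suc; _+_; _*_; _∸_; _≤_; _<_; _≤?_)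
open import Data.Nat.DivMod using (_/_)
open import Data.Fin using (Fin)
open import Data.List using (List; []; _∷_; _++_)
open import Data.List.Membership.Propositional using (_∈_)
open import Data.List.Relation.Unary.Unique.Propositional using (Unique)
open import Data.Product using (Σ; _×_)
open import Data.Empty using (⊥)
open import Relation.Nullary using (¬_; yes; no)
open import Relation.Binary.PropositionalEquality using (_≡_; _≢_)

-- ⌈ √ m ⌉ : the least r with m ≤ r * r (found by linear search; r = m always works)
ceilSqrtFrom : ℕ → ℕ → ℕ → ℕ
ceilSqrtFrom m zero r = r
ceilSqrtFrom m (suc fuel) r with m ≤? r * r
... | yes _ = r
... | no _ = ceilSqrtFrom m fuel (suc r)

ceilSqrt : ℕ → ℕ
ceilSqrt m = ceilSqrtFrom m m 0

-- ⌈ a / b ⌉ for b > 0 (value at b = 0 is irrelevant, set to 0)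
ceilDiv : ℕ → ℕ → ℕ
ceilDiv a zero = 0
ceilDiv a (suc b) = (a + b) / suc b

r₀ : ℕ → ℕ
r₀ k = ceilSqrt (2 * k)

ℓ₀ : ℕ → ℕ
ℓ₀ k = ceilDiv (k ∸ 1) (ceilSqrt (2 * k)) + 2

f : ℕ → ℕ
f k = ℓ₀ k * ℓ₀ k * r₀ k

-- An edge-colouring of the complete graph K_n (vertex set Fin n) with j colours:
-- a symmetric colour assignment to pairs; only pairs of distinct vertices are edges.
record EdgeColouring (n j : ℕ) : Set where
  field
    colour : Fin n → Fin n → Fin j
    symm   : ∀ u v → colour u v ≡ colour v u
open EdgeColouring public

edgeColours : ∀ {n j} → EdgeColouring n j → List (Fin n) → List (Fin j)
edgeColours c [] = []
edgeColours c (x ∷ []) = []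
edgeColours c (x ∷ y ∷ rest) = colour c x y ∷ edgeColours c (y ∷ rest)

-- In K_n every sequence of distinct vertices is a path.  A u–v path is given by
-- its list of internal vertices I; its vertex sequence is u ∷ I ++ [ v ].
pathVertices : ∀ {n} → Fin n → List (Fin n) → Fin n → List (Fin n)
pathVertices u I v = u ∷ (I ++ (v ∷ []))

IsPath : ∀ {n} → Fin n → List (Fin n) → Fin n → Set
IsPath u I v = Unique (pathVertices u I v)

IsRainbow : ∀ {n j} → EdgeColouring n j → Fin n → List (Fin n) → Fin n → Set
IsRainbow c u I v = Unique (edgeColours c (pathVertices u I v))

Disjoint : ∀ {n} → List (Fin n) → List (Fin n) → Set
Disjoint I J = ∀ x → x ∈ I → x ∈ J → ⊥

RainbowKConnected : ∀ {n j} → ℕ → EdgeColouring n j → Set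
RainbowKConnected {n} k c =
  ∀ (u v : Fin n) → u ≢ v →
  Σ (Fin k → List (Fin n)) λ P →
    (∀ i → IsPath u (P i) v × IsRainbow c u (P i) v) ×
    (∀ i i′ → i ≢ i′ → P i ≢ P i′ × Disjoint (P i) (P i′))

RcKn≡ : ℕ → ℕ → ℕ → Set
RcKn≡ k n j =
  Σ (EdgeColouring n j) (RainbowKConnected k) ×
  (∀ j′ → j′ < j → ¬ Σ (EdgeColouring n j′) (RainbowKConnected k))

-- One colour is not enough: in a monochromatic K_n the only rainbow u–v path is the edge uv.
-- For two colours, place the vertices in a grid of triples (x , y , z) with y < ℓ₀ and z < r₀ and
-- colour an edge 0 when its ends agree in some coordinate, 1 otherwise.  A vertex w agreeing with u
-- in some coordinate and with v in none gives the rainbow path u – w – v.  Depending on which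
-- coordinates u and v share, such vertices fill one or two boxes of the grid, and the choice of ℓ₀
-- and r₀ makes these boxes contain at least k − 1 vertices; with the edge uv this gives k internally
-- disjoint rainbow paths.
module Submission where

open import Defs
open import Data.Empty using (⊥-elim)
open import Data.Fin using (Fin; zero; suc; toℕ; inject≤)
open import Data.Fin.Properties using (inject≤-injective; toℕ-injective; toℕ<n; toℕ-fromℕ<)
open import Data.List using (List; []; _∷_; _++_; length; lookup; map; filter; upTo; cartesianProduct)
open import Data.List.Properties using (length-map; length-++; filter-all; filter-accept; filter-reject; ∷-injectiveˡ; length-upTo)
open import Data.List.Membership.Propositional using (_∈_)
open import Data.List.Membership.Propositional.Properties using (∈-lookup; ∈-filter⁻; ∈-cartesianProduct⁻; ∈-upTo⁻)
open import Data.List.Relation.Unary.All as All using (All; []; _∷_)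
import Data.List.Relation.Unary.All.Properties as Allₚ
open import Data.List.Relation.Unary.Any using (here)
open import Data.List.Relation.Unary.AllPairs using ([]; _∷_)
open import Data.List.Relation.Unary.Unique.Propositional using (Unique)
import Data.List.Relation.Unary.Unique.Propositional.Properties as Unique
open import Data.Nat using (ℕ; zero; suc; _+_; _*_; _≤_; _<_; s≤s; z≤n; _≟_; _≤?_; NonZero; >-nonZero; s≤s⁻¹)
open import Data.Nat.DivMod
open import Data.Nat.Divisibility using (n∣m*n)
open import Data.Nat.Properties
open import Data.Nat.Tactic.RingSolver using (solve-∀)
open import Data.Product using (Σ; _×_; _,_; proj₁; proj₂; map₂)
open import Data.Sum as Sum using (_⊎_; inj₁; inj₂)
open import Function using (_∘_)
open import Relation.Nullary using (¬_; Dec; yes; no; ¬?; _⊎-dec_)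
open import Relation.Binary.Definitions using (tri<; tri≈; tri>)
open import Relation.Binary.PropositionalEquality

lookup-injective : ∀ {A : Set} {xs : List A} → Unique xs → ∀ i j → lookup xs i ≡ lookup xs j → i ≡ j
lookup-injective {xs = x ∷ xs} (_ ∷ _)    zero    zero    _  = refl
lookup-injective {xs = x ∷ xs} (x∉ ∷ _)   zero    (suc j) eq = ⊥-elim (All.lookup x∉ (∈-lookup j) eq)
lookup-injective {xs = x ∷ xs} (x∉ ∷ _)   (suc i) zero    eq = ⊥-elim (All.lookup x∉ (∈-lookup i) (sym eq))
lookup-injective {xs = x ∷ xs} (_ ∷ uniq) (suc i) (suc j) eq = cong suc (lookup-injective uniq i j eq)

without : ℕ → List ℕ → List ℕ
without a = filter (λ i → ¬? (i ≟ a))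

∈-without⁻ : ∀ {a i} xs → i ∈ without a xs → i ∈ xs × i ≢ a
∈-without⁻ xs = ∈-filter⁻ (λ i → ¬? (i ≟ _))

without-unique : ∀ a {xs} → Unique xs → Unique (without a xs)
without-unique a = Unique.filter⁺ (λ i → ¬? (i ≟ a))

length≤1+length-without : ∀ a xs → Unique xs → length xs ≤ suc (length (without a xs))
length≤1+length-without a []       _           = z≤n
length≤1+length-without a (x ∷ xs) (x∉ ∷ uniq) with x ≟ a
... | yes refl = s≤s (≤-reflexive (sym (cong length (begin
  without x (x ∷ xs)  ≡⟨ filter-reject (λ i → ¬? (i ≟ x)) (λ x≢x → x≢x refl) ⟩
  without x xs        ≡⟨ filter-all (λ i → ¬? (i ≟ x)) (All.map ≢-sym x∉) ⟩
  xs                  ∎))))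
  where open ≡-Reasoning
... | no x≢a   = begin
  suc (length xs)                       ≤⟨ s≤s (length≤1+length-without a xs uniq) ⟩
  suc (suc (length (without a xs)))     ≡⟨ cong (suc ∘ length) (filter-accept (λ i → ¬? (i ≟ a)) x≢a) ⟨
  suc (length (without a (x ∷ xs)))     ∎
  where open ≤-Reasoning

others : ℕ → ℕ → List ℕ
others N a = without a (upTo N)

others-unique : ∀ N a → Unique (others N a)
others-unique N a = without-unique a (Unique.upTo⁺ N)

∈-others⁻ : ∀ {N a i} → i ∈ others N a → i < N × i ≢ a
∈-others⁻ {N} i∈ with i∈upTo , i≢a ← ∈-without⁻ (upTo N) i∈ = ∈-upTo⁻ i∈upTo , i≢a

N≤1+length-others : ∀ N a → N ≤ suc (length (others N a))
N≤1+length-others N a =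
  subst (_≤ suc (length (others N a))) (length-upTo N) (length≤1+length-without a (upTo N) (Unique.upTo⁺ N))

Fin1-unique : (i j : Fin 1) → i ≡ j
Fin1-unique zero zero = refl

monochromatic-rainbow⇒direct : ∀ {n} (c : EdgeColouring n 1) u I v → IsRainbow c u I v → I ≡ []
monochromatic-rainbow⇒direct c u []          v _                   = refl
monochromatic-rainbow⇒direct c u (x ∷ [])    v ((c₁≢c₂ ∷ _) ∷ _) = ⊥-elim (c₁≢c₂ (Fin1-unique _ _))
monochromatic-rainbow⇒direct c u (x ∷ y ∷ I) v ((c₁≢c₂ ∷ _) ∷ _) = ⊥-elim (c₁≢c₂ (Fin1-unique _ _))

rainbowKConnected⇒2≤colours : ∀ {k n} → 2 ≤ k → 2 ≤ n → ∀ j → j < 2 → ¬ Σ (EdgeColouring n j) (RainbowKConnected k)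
rainbowKConnected⇒2≤colours (s≤s (s≤s _)) (s≤s (s≤s _)) 0 (s≤s z≤n) (c , _) with () ← colour c zero zero
rainbowKConnected⇒2≤colours (s≤s (s≤s _)) (s≤s (s≤s _)) 1 (s≤s (s≤s z≤n)) (c , rc)
  with P , paths , distinct ← rc zero (suc zero) (λ ())
  = proj₁ (distinct zero (suc zero) (λ ())) (trans (direct zero) (sym (direct (suc zero))))
  where
  direct : ∀ i → P i ≡ []
  direct i = monochromatic-rainbow⇒direct c zero (P i) (suc zero) (proj₂ (paths i))

Separating : ∀ {n j} → EdgeColouring n j → Fin n → Fin n → Fin n → Set
Separating c u v w = w ≢ u × w ≢ v × colour c u w ≢ colour c v w

Separators : ∀ {n j} → EdgeColouring n j → ℕ → Fin n → Fin n → Set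
Separators {n} c K u v = Σ (List (Fin n)) λ ws → Unique ws × K ≤ length ws × All (Separating c u v) ws

-- The direct edge together with the paths u – w – v through K separating vertices w.
rainbowKConnected-of-separators : ∀ {n j K} (c : EdgeColouring n j) →
  (∀ u v → u ≢ v → Separators c K u v) → RainbowKConnected (suc K) c
rainbowKConnected-of-separators {n} {K = K} c separators u v u≢v
  with ws , ws-unique , K≤|ws| , ws-separating ← separators u v u≢v
  = P , rainbow-path , internally-disjoint
  where
  w : Fin K → Fin n
  w i = lookup ws (inject≤ i K≤|ws|)

  w-injective : ∀ i j → w i ≡ w j → i ≡ j
  w-injective i j eq = inject≤-injective K≤|ws| K≤|ws| i j (lookup-injective ws-unique _ _ eq)

  w-separating : ∀ i → Separating c u v (w i)
  w-separating i = All.lookup ws-separating (∈-lookup (inject≤ i K≤|ws|))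

  P : Fin (suc K) → List (Fin n)
  P zero    = []
  P (suc i) = w i ∷ []

  rainbow-path : ∀ i → IsPath u (P i) v × IsRainbow c u (P i) v
  rainbow-path zero    = ((u≢v ∷ []) ∷ [] ∷ []) , ([] ∷ [])
  rainbow-path (suc i) with w≢u , w≢v , colours≢ ← w-separating i =
    ((≢-sym w≢u ∷ u≢v ∷ []) ∷ (w≢v ∷ []) ∷ [] ∷ []) ,
    ((λ eq → colours≢ (trans eq (symm c (w i) v))) ∷ []) ∷ [] ∷ []

  internally-disjoint : ∀ i i′ → i ≢ i′ → P i ≢ P i′ × Disjoint (P i) (P i′)
  internally-disjoint zero    zero     i≢i′ = ⊥-elim (i≢i′ refl)
  internally-disjoint zero    (suc _)  _    = (λ ()) , (λ _ ())
  internally-disjoint (suc _) zero     _    = (λ ()) , (λ _ _ ())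
  internally-disjoint (suc i) (suc i′) i≢i′ =
    (λ eq → i≢i′ (cong suc (w-injective i i′ (∷-injectiveˡ eq)))) ,
    (λ { _ (here refl) (here eq) → i≢i′ (cong suc (w-injective i i′ eq)) })

ceilSqrtFrom-spec : ∀ m fuel r → (∀ s → s < r → s * s < m) → m ≤ (r + fuel) * (r + fuel) →
  m ≤ ceilSqrtFrom m fuel r * ceilSqrtFrom m fuel r × (∀ s → s < ceilSqrtFrom m fuel r → s * s < m)
ceilSqrtFrom-spec m zero       r below m≤ = subst (λ t → m ≤ t * t) (+-identityʳ r) m≤ , below
ceilSqrtFrom-spec m (suc fuel) r below m≤ with m ≤? r * r
... | yes m≤r² = m≤r² , below
... | no  m≰r² = ceilSqrtFrom-spec m fuel (suc r) below′ (subst (λ t → m ≤ t * t) (+-suc r fuel) m≤)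
  where
  below′ : ∀ s → s < suc r → s * s < m
  below′ s (s≤s s≤r) with m≤n⇒m<n∨m≡n s≤r
  ... | inj₁ s<r  = below s s<r
  ... | inj₂ refl = ≰⇒> m≰r²

ceilSqrt-spec : ∀ m → m ≤ ceilSqrt m * ceilSqrt m × (∀ s → s < ceilSqrt m → s * s < m)
ceilSqrt-spec zero    = z≤n , λ _ ()
ceilSqrt-spec (suc m) = ceilSqrtFrom-spec (suc m) (suc m) 0 (λ _ ()) (m≤m*n (suc m) (suc m))

module CeilingBounds (K r : ℕ) .{{_ : NonZero r}} (1≤K : 1 ≤ K)
                     (2[1+K]≤R² : 2 * suc K ≤ suc r * suc r)
                     (R-minimal : ∀ s → s < suc r → s * s < 2 * suc K) where

  R q : ℕ
  R = suc r
  q = ceilDiv K R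

  K≤q*R : K ≤ q * R
  K≤q*R = +-cancelʳ-≤ r K (q * R) (begin
    K + r                 ≡⟨ m≡m%n+[m/n]*n (K + r) R ⟩
    (K + r) % R + q * R   ≤⟨ +-monoˡ-≤ (q * R) (s≤s⁻¹ (m%n<n (K + r) R)) ⟩
    r + q * R             ≡⟨ +-comm r (q * R) ⟩
    q * R + r             ∎)
    where open ≤-Reasoning

  q*R≤K+r : q * R ≤ K + r
  q*R≤K+r = m/n*n≤m (K + r) R

  R≤1+K : R ≤ suc K
  R≤1+K = ≮⇒≥ λ 1+K<R → <-irrefl refl (<-≤-trans (R-minimal (suc K) 1+K<R) (*-monoˡ-≤ (suc K) (s≤s 1≤K)))

  q<R : q < R
  q<R = *-cancelʳ-< R q R (begin-strict
    q * R                ≤⟨ q*R≤K+r ⟩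
    K + r                ≤⟨ +-monoʳ-≤ K (s≤s⁻¹ R≤1+K) ⟩
    K + K                <⟨ +-mono-< (n<1+n K) (n<1+n K) ⟩
    suc K + suc K        ≡⟨ cong (suc K +_) (+-identityʳ (suc K)) ⟨
    2 * suc K            ≤⟨ 2[1+K]≤R² ⟩
    R * R                ∎)
    where open ≤-Reasoning

  K≤[1+q]*r : K ≤ suc q * r
  K≤[1+q]*r = begin
    K          ≤⟨ K≤q*R ⟩
    q * R      ≡⟨ *-suc q r ⟩
    q + q * r  ≤⟨ +-monoˡ-≤ (q * r) (s≤s⁻¹ q<R) ⟩
    r + q * r  ∎
    where open ≤-Reasoning

  K≤q*r+q*r : K ≤ q * r + q * r
  K≤q*r+q*r = begin
    K              ≤⟨ K≤q*R ⟩
    q * R          ≡⟨ *-suc q r ⟩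
    q + q * r      ≤⟨ +-monoˡ-≤ (q * r) (m≤m*n q r) ⟩
    q * r + q * r  ∎
    where open ≤-Reasoning

  R²≤2K+2R : R * R ≤ 2 * K + 2 * R
  R²≤2K+2R = begin
    R * R              ≡⟨ square-suc r ⟩
    suc (r * r) + 2 * r ≤⟨ +-monoˡ-≤ (2 * r) (R-minimal r (n<1+n r)) ⟩
    2 * suc K + 2 * r  ≡⟨ shift K r ⟩
    2 * K + 2 * R      ∎
    where
    open ≤-Reasoning
    square-suc : ∀ r → suc r * suc r ≡ suc (r * r) + 2 * r
    square-suc = solve-∀
    shift : ∀ K r → 2 * suc K + 2 * r ≡ 2 * K + 2 * suc r
    shift = solve-∀

  K≤[1+q]²+[1+q]² : K ≤ suc q * suc q + suc q * suc q
  K≤[1+q]²+[1+q]² = *-cancelʳ-≤ K (suc q * suc q + suc q * suc q) (R * R) (begin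
    K * (R * R)                                ≤⟨ *-monoʳ-≤ K R²≤2K+2R ⟩
    K * (2 * K + 2 * R)                        ≤⟨ m≤m+n _ (2 * K * R + 2 * R * R) ⟩
    K * (2 * K + 2 * R) + (2 * K * R + 2 * R * R) ≡⟨ expand K R ⟩
    2 * ((K + R) * (K + R))                    ≤⟨ *-monoʳ-≤ 2 (*-mono-≤ K+R≤[1+q]*R K+R≤[1+q]*R) ⟩
    2 * ((suc q * R) * (suc q * R))            ≡⟨ regroup (suc q) R ⟩
    (suc q * suc q + suc q * suc q) * (R * R)  ∎)
    where
    open ≤-Reasoning
    expand : ∀ K R → K * (2 * K + 2 * R) + (2 * K * R + 2 * R * R) ≡ 2 * ((K + R) * (K + R))
    expand = solve-∀
    regroup : ∀ a R → 2 * ((a * R) * (a * R)) ≡ (a * a + a * a) * (R * R)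
    regroup = solve-∀
    K+R≤[1+q]*R : K + R ≤ suc q * R
    K+R≤[1+q]*R = subst (K + R ≤_) (+-comm (q * R) R) (+-monoˡ-≤ R K≤q*R)

[m+kn]/n≡k : ∀ {m} k {n} .{{_ : NonZero n}} → m < n → (m + k * n) / n ≡ k
[m+kn]/n≡k {m} k {n} m<n = begin
  (m + k * n) / n    ≡⟨ +-distrib-/-∣ʳ m (n∣m*n k) ⟩
  m / n + k * n / n  ≡⟨ cong₂ _+_ (m<n⇒m/n≡0 m<n) (m*n/n≡m k n) ⟩
  k                  ∎
  where open ≡-Reasoning

[m+kn]%n≡m : ∀ {m} k {n} .{{_ : NonZero n}} → m < n → (m + k * n) % n ≡ m
[m+kn]%n≡m {m} k {n} m<n = trans ([m+kn]%n≡m%n m k n) (m<n⇒m%n≡m m<n)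

Triple : Set
Triple = ℕ × ℕ × ℕ

box : List ℕ → List ℕ → List ℕ → List Triple
box xs ys zs = cartesianProduct xs (cartesianProduct ys zs)

length-cartesianProduct : ∀ {A B : Set} (xs : List A) (ys : List B) →
                          length (cartesianProduct xs ys) ≡ length xs * length ys
length-cartesianProduct []       ys = refl
length-cartesianProduct (x ∷ xs) ys = begin
  length (map (x ,_) ys ++ cartesianProduct xs ys)        ≡⟨ length-++ (map (x ,_) ys) ⟩
  length (map (x ,_) ys) + length (cartesianProduct xs ys) ≡⟨ cong₂ _+_ (length-map (x ,_) ys) (length-cartesianProduct xs ys) ⟩
  length ys + length xs * length ys                        ∎
  where open ≡-Reasoning

length-box : ∀ xs ys zs → length (box xs ys zs) ≡ length xs * (length ys * length zs)
length-box xs ys zs = trans (length-cartesianProduct xs _) (cong (length xs *_) (length-cartesianProduct ys zs))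

box-unique : ∀ {xs ys zs} → Unique xs → Unique ys → Unique zs → Unique (box xs ys zs)
box-unique ux uy uz = Unique.cartesianProduct⁺ ux (Unique.cartesianProduct⁺ uy uz)

∈-box⁻ : ∀ xs ys zs {x y z} → (x , y , z) ∈ box xs ys zs → x ∈ xs × y ∈ ys × z ∈ zs
∈-box⁻ xs ys zs t∈ with x∈ , yz∈ ← ∈-cartesianProduct⁻ xs _ t∈ = x∈ , ∈-cartesianProduct⁻ ys zs yz∈

Agree : Triple → Triple → Set
Agree (x , y , z) (x′ , y′ , z′) = x ≡ x′ ⊎ y ≡ y′ ⊎ z ≡ z′

agree? : ∀ s t → Dec (Agree s t)
agree? (x , y , z) (x′ , y′ , z′) = x ≟ x′ ⊎-dec y ≟ y′ ⊎-dec z ≟ z′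

agree-refl : ∀ t → Agree t t
agree-refl _ = inj₁ refl

agree-sym : ∀ s t → Agree s t → Agree t s
agree-sym _ _ = Sum.map sym (Sum.map sym sym)

disagree : ∀ {x y z x′ y′ z′} → x ≢ x′ → y ≢ y′ → z ≢ z′ → ¬ Agree (x , y , z) (x′ , y′ , z′)
disagree x≢ _  _  (inj₁ x≡)        = x≢ x≡
disagree _  y≢ _  (inj₂ (inj₁ y≡)) = y≢ y≡
disagree _  _  z≢ (inj₂ (inj₂ z≡)) = z≢ z≡

Separates : Triple → Triple → Triple → Set
Separates a b t = Agree a t × ¬ Agree b t × t ≢ a

Separator : Triple → Triple → Triple → Set
Separator a b t = Separates a b t ⊎ Separates b a t

colourOf : ∀ {P : Set} → Dec P → Fin 2
colourOf (yes _) = zero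
colourOf (no _)  = suc zero

colourOf-cong : ∀ {P Q : Set} (p? : Dec P) (q? : Dec Q) → (P → Q) → (Q → P) → colourOf p? ≡ colourOf q?
colourOf-cong (yes _) (yes _) _   _   = refl
colourOf-cong (yes p) (no ¬q) p→q _   = ⊥-elim (¬q (p→q p))
colourOf-cong (no ¬p) (yes q) _   q→p = ⊥-elim (¬p (q→p q))
colourOf-cong (no _)  (no _)  _   _   = refl

colourOf-yes : ∀ {P : Set} (p? : Dec P) → P → colourOf p? ≡ zero
colourOf-yes (yes _) _ = refl
colourOf-yes (no ¬p) p = ⊥-elim (¬p p)

colourOf-no : ∀ {P : Set} (p? : Dec P) → ¬ P → colourOf p? ≡ suc zero
colourOf-no (yes p) ¬p = ⊥-elim (¬p p)
colourOf-no (no _)  _  = refl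

-- Vertex i of K_n sits at position (x , y , z) of a grid of layers x, each an L × R array, i.e.
-- i = z + (y + x L) R.  Only the layers x < L are guaranteed to be complete.
module Grid (n q r : ℕ) .{{_ : NonZero n}} where

  L R : ℕ
  L = 2 + q
  R = suc r

  index : Triple → ℕ
  index (x , y , z) = z + (y + x * L) * R

  coords : ℕ → Triple
  coords i = i / R / L , i / R % L , i % R

  InGrid : Triple → Set
  InGrid (_ , y , z) = y < L × z < R

  Occupied : Triple → Set
  Occupied t = InGrid t × index t < n

  coords-index : ∀ x y z → y < L → z < R → coords (index (x , y , z)) ≡ (x , y , z)
  coords-index x y z y<L z<R
    rewrite [m+kn]/n≡k (y + x * L) z<R | [m+kn]%n≡m (y + x * L) z<R
          | [m+kn]/n≡k x y<L | [m+kn]%n≡m x y<L = refl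

  index-coords : ∀ i → index (coords i) ≡ i
  index-coords i = begin
    i % R + (i / R % L + i / R / L * L) * R  ≡⟨ cong (λ m → i % R + m * R) (m≡m%n+[m/n]*n (i / R) L) ⟨
    i % R + i / R * R                        ≡⟨ m≡m%n+[m/n]*n i R ⟨
    i                                        ∎
    where open ≡-Reasoning

  coords-inGrid : ∀ i → InGrid (coords i)
  coords-inGrid i = m%n<n (i / R) L , m%n<n i R

  index-< : ∀ {X x y z} → x < X → y < L → z < R → index (x , y , z) < X * L * R
  index-< {X} {x} {y} {z} x<X y<L z<R = begin-strict
    z + (y + x * L) * R  <⟨ +-monoˡ-< ((y + x * L) * R) z<R ⟩
    suc (y + x * L) * R  ≤⟨ *-monoˡ-≤ R (+-monoˡ-≤ (x * L) y<L) ⟩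
    suc x * L * R        ≤⟨ *-monoˡ-≤ R (*-monoˡ-≤ L x<X) ⟩
    X * L * R            ∎
    where open ≤-Reasoning

  X*L*R≤index : ∀ X y z → X * L * R ≤ index (X , y , z)
  X*L*R≤index X y z = ≤-trans (*-monoˡ-≤ R (m≤n+m (X * L) y)) (m≤n+m _ z)

  -- Positions that are not occupied wrap around; vertex is only applied to occupied ones.
  vertex : Triple → Fin n
  vertex t = index t mod n

  position : Fin n → Triple
  position u = coords (toℕ u)

  position-occupied : ∀ u → Occupied (position u)
  position-occupied u = coords-inGrid (toℕ u) , subst (_< n) (sym (index-coords (toℕ u))) (toℕ<n u)

  position-injective : ∀ {u v} → position u ≡ position v → u ≡ v
  position-injective {u} {v} eq =
    toℕ-injective (trans (sym (index-coords (toℕ u))) (trans (cong index eq) (index-coords (toℕ v))))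

  position-vertex : ∀ {t} → Occupied t → position (vertex t) ≡ t
  position-vertex {x , y , z} ((y<L , z<R) , i<n) = begin
    coords (toℕ (index (x , y , z) mod n))  ≡⟨ cong coords (toℕ-fromℕ< (m%n<n (index (x , y , z)) n)) ⟩
    coords (index (x , y , z) % n)          ≡⟨ cong coords (m<n⇒m%n≡m i<n) ⟩
    coords (index (x , y , z))              ≡⟨ coords-index x y z y<L z<R ⟩
    (x , y , z)                             ∎
    where open ≡-Reasoning

  agreementColouring : EdgeColouring n 2
  agreementColouring = record
    { colour = λ u w → colourOf (agree? (position u) (position w))
    ; symm   = λ u w → colourOf-cong (agree? _ _) (agree? _ _) (agree-sym _ _) (agree-sym _ _)
    }

  separates-vertex : ∀ {u v t} → Occupied t → Separates (position u) (position v) t →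
                     Separating agreementColouring u v (vertex t)
  separates-vertex {u} {v} {t} occupied (agree-u , ¬agree-v , t≢u) =
    (λ w≡u → t≢u (trans (sym w-at-t) (cong position w≡u))) ,
    (λ w≡v → ¬agree-v (subst (Agree (position v)) (trans (cong position (sym w≡v)) w-at-t) (agree-refl _))) ,
    (λ colours≡ → 0≢1 (trans (sym colour-u) (trans colours≡ colour-v)))
    where
    w = vertex t
    w-at-t : position w ≡ t
    w-at-t = position-vertex occupied
    colour-u : colourOf (agree? (position u) (position w)) ≡ zero
    colour-u = colourOf-yes (agree? _ _) (subst (Agree (position u)) (sym w-at-t) agree-u)
    colour-v : colourOf (agree? (position v) (position w)) ≡ suc zero
    colour-v = colourOf-no (agree? _ _) (λ agree → ¬agree-v (subst (Agree (position v)) w-at-t agree))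
    0≢1 : zero ≢ suc zero
    0≢1 ()

  separator-vertex : ∀ {u v t} → Occupied t → Separator (position u) (position v) t →
                     Separating agreementColouring u v (vertex t)
  separator-vertex occupied (inj₁ separates) = separates-vertex occupied separates
  separator-vertex occupied (inj₂ separates) with w≢v , w≢u , colours≢ ← separates-vertex occupied separates =
    w≢u , w≢v , ≢-sym colours≢

  map-position-vertex : ∀ {T} → All Occupied T → map position (map vertex T) ≡ T
  map-position-vertex []       = refl
  map-position-vertex (o ∷ os) = cong₂ _∷_ (position-vertex o) (map-position-vertex os)

  SideSeparators : Triple → Triple → ℕ → Set
  SideSeparators a b K =
    Σ (List Triple) λ T → Unique T × K ≤ length T × All (λ t → Occupied t × Separates a b t) T

  GridSeparators : Triple → Triple → ℕ → Set
  GridSeparators a b K =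
    Σ (List Triple) λ T → Unique T × K ≤ length T × All (λ t → Occupied t × Separator a b t) T

  box-separators : ∀ {a b} xs ys zs → Unique xs → Unique ys → Unique zs →
    (∀ {x y z} → x ∈ xs → y ∈ ys → z ∈ zs → Occupied (x , y , z) × Separates a b (x , y , z)) →
    SideSeparators a b (length xs * (length ys * length zs))
  box-separators xs ys zs ux uy uz separates =
    box xs ys zs , box-unique ux uy uz , ≤-reflexive (sym (length-box xs ys zs)) ,
    All.tabulate λ {(x , y , z)} t∈ →
      let x∈ , y∈ , z∈ = ∈-box⁻ xs ys zs t∈ in separates x∈ y∈ z∈

  side-weaken : ∀ {a b K K′} → K ≤ K′ → SideSeparators a b K′ → SideSeparators a b K
  side-weaken K≤K′ (T , uniq , K′≤|T| , good) = T , uniq , ≤-trans K≤K′ K′≤|T| , good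

  grid-weaken : ∀ {a b K K′} → K ≤ K′ → GridSeparators a b K′ → GridSeparators a b K
  grid-weaken K≤K′ (T , uniq , K′≤|T| , good) = T , uniq , ≤-trans K≤K′ K′≤|T| , good

  oneSided : ∀ {a b K} → SideSeparators a b K → GridSeparators a b K
  oneSided (T , uniq , long , good) = T , uniq , long , All.map (map₂ inj₁) good

  oneSided-swap : ∀ {a b K} → SideSeparators b a K → GridSeparators a b K
  oneSided-swap (T , uniq , long , good) = T , uniq , long , All.map (map₂ inj₂) good

  twoSided : ∀ {a b K₁ K₂} → SideSeparators a b K₁ → SideSeparators b a K₂ → GridSeparators a b (K₁ + K₂)
  twoSided {a} (T₁ , uniq₁ , long₁ , good₁) (T₂ , uniq₂ , long₂ , good₂) =
    T₁ ++ T₂ ,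
    Unique.++⁺ uniq₁ uniq₂ disjoint ,
    subst (_ ≤_) (sym (length-++ T₁)) (+-mono-≤ long₁ long₂) ,
    Allₚ.++⁺ (All.map (map₂ inj₁) good₁) (All.map (map₂ inj₂) good₂)
    where
    disjoint : ∀ {t} → ¬ (t ∈ T₁ × t ∈ T₂)
    disjoint (t∈₁ , t∈₂)
      with _ , agree-a , _ ← All.lookup good₁ t∈₁ | _ , _ , ¬agree-a , _ ← All.lookup good₂ t∈₂
      = ¬agree-a agree-a

  vertex-separators : ∀ {u v K} → GridSeparators (position u) (position v) K → Separators agreementColouring K u v
  vertex-separators (T , uniq , long , good) =
    map vertex T ,
    Unique.map⁻ (subst Unique (sym (map-position-vertex (All.map proj₁ good))) uniq) ,
    subst (_ ≤_) (sym (length-map vertex T)) long ,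
    Allₚ.map⁺ (All.map (λ (occupied , separator) → separator-vertex occupied separator) good)

  suc-q≤length-others-L : ∀ a → suc q ≤ length (others L a)
  suc-q≤length-others-L a = s≤s⁻¹ (N≤1+length-others L a)

  q≤length-without-others-L : ∀ a b → q ≤ length (without b (others L a))
  q≤length-without-others-L a b =
    s≤s⁻¹ (≤-trans (suc-q≤length-others-L a) (length≤1+length-without b (others L a) (others-unique L a)))

  r≤length-others-R : ∀ a → r ≤ length (others R a)
  r≤length-others-R a = s≤s⁻¹ (N≤1+length-others R a)

  occupied-below : ∀ {x y z X y′ z′} → x < X → y < L → z < R → Occupied (X , y′ , z′) → Occupied (x , y , z)
  occupied-below {X = X} {y′} {z′} x<X y<L z<R (_ , X-occupied) =
    (y<L , z<R) , <-≤-trans (index-< x<X y<L z<R) (≤-trans (X*L*R≤index X y′ z′) (<⇒≤ X-occupied))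

  sharedX-separators : ∀ {xa ya za xb yb zb} → xa < xb → ya ≡ yb → za ≡ zb → Occupied (xb , yb , zb) →
             SideSeparators (xa , ya , za) (xb , yb , zb) (suc q * r)
  sharedX-separators {xa} {ya} {za} xa<xb refl refl b-occupied =
    side-weaken (≤-trans (≤-reflexive (sym (*-identityˡ _)))
                         (*-monoʳ-≤ 1 (*-mono-≤ (suc-q≤length-others-L ya) (r≤length-others-R za))))
      (box-separators (xa ∷ []) (others L ya) (others R za) ([] ∷ []) (others-unique L ya) (others-unique R za)
        λ { (here refl) y∈ z∈ →
          let y<L , y≢ya = ∈-others⁻ y∈ ; z<R , z≢za = ∈-others⁻ z∈ in
          occupied-below xa<xb y<L z<R b-occupied ,
          inj₁ refl , disagree (≢-sym (<⇒≢ xa<xb)) (≢-sym y≢ya) (≢-sym z≢za) , λ { refl → y≢ya refl } })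

  module _ (fits : L * L * R ≤ n) where

    occupied-front : ∀ {x y z} → x < L → y < L → z < R → Occupied (x , y , z)
    occupied-front x<L y<L z<R = (y<L , z<R) , <-≤-trans (index-< x<L y<L z<R) fits

    sharedY-separators : ∀ {xa ya za xb yb zb} → ya ≢ yb → ya < L →
                    SideSeparators (xa , ya , za) (xb , yb , zb) (q * r)
    sharedY-separators {xa} {ya} {za} {xb} {yb} {zb} ya≢yb ya<L =
      side-weaken (*-mono-≤ (q≤length-without-others-L xb xa) (≤-trans (r≤length-others-R zb) (≤-reflexive (sym (*-identityˡ _)))))
        (box-separators xs (ya ∷ []) (others R zb) (without-unique xa (others-unique L xb)) ([] ∷ []) (others-unique R zb)
          λ { x∈ (here refl) z∈ →
            let x∈others , x≢xa = ∈-without⁻ (others L xb) x∈ ; x<L , x≢xb = ∈-others⁻ x∈others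
                z<R , z≢zb = ∈-others⁻ z∈ in
            occupied-front x<L ya<L z<R ,
            inj₂ (inj₁ refl) , disagree (≢-sym x≢xb) (≢-sym ya≢yb) (≢-sym z≢zb) , λ { refl → x≢xa refl } })
      where
      xs = without xa (others L xb)

    sharedZ-separators : ∀ {xa ya za xb yb zb} → ya ≡ yb → za ≢ zb → za < R →
               SideSeparators (xa , ya , za) (xb , yb , zb) (suc q * suc q)
    sharedZ-separators {xa} {ya} {za} {xb} {yb} {zb} refl za≢zb za<R =
      side-weaken (*-mono-≤ (suc-q≤length-others-L xb) (≤-trans (suc-q≤length-others-L ya) (≤-reflexive (sym (*-identityʳ _)))))
        (box-separators (others L xb) (others L ya) (za ∷ []) (others-unique L xb) (others-unique L ya) ([] ∷ [])
          λ { x∈ y∈ (here refl) →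
            let x<L , x≢xb = ∈-others⁻ x∈ ; y<L , y≢ya = ∈-others⁻ y∈ in
            occupied-front x<L y<L za<R ,
            inj₂ (inj₂ refl) , disagree (≢-sym x≢xb) (≢-sym y≢ya) (≢-sym za≢zb) , λ { refl → y≢ya refl } })

    module _ {K : ℕ} (K≤[1+q]*r : K ≤ suc q * r) (K≤q*r+q*r : K ≤ q * r + q * r)
             (K≤[1+q]²+[1+q]² : K ≤ suc q * suc q + suc q * suc q) where

      grid-separators : ∀ a b → a ≢ b → Occupied a → Occupied b → GridSeparators a b K
      grid-separators (xa , ya , za) (xb , yb , zb) a≢b a-occupied@((ya<L , za<R) , _) b-occupied@((yb<L , zb<R) , _)
        with ya ≟ yb | za ≟ zb
      ... | no ya≢yb | _ =
        grid-weaken K≤q*r+q*r (twoSided (sharedY-separators ya≢yb ya<L) (sharedY-separators (≢-sym ya≢yb) yb<L))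
      ... | yes ya≡yb | no za≢zb =
        grid-weaken K≤[1+q]²+[1+q]² (twoSided (sharedZ-separators ya≡yb za≢zb za<R) (sharedZ-separators (sym ya≡yb) (≢-sym za≢zb) zb<R))
      ... | yes ya≡yb | yes za≡zb with <-cmp xa xb
      ...   | tri< xa<xb _ _ = grid-weaken K≤[1+q]*r (oneSided (sharedX-separators xa<xb ya≡yb za≡zb b-occupied))
      ...   | tri≈ _ xa≡xb _ = ⊥-elim (a≢b (cong₂ _,_ xa≡xb (cong₂ _,_ ya≡yb za≡zb)))
      ...   | tri> _ _ xb<xa = grid-weaken K≤[1+q]*r (oneSided-swap (sharedX-separators xb<xa (sym ya≡yb) (sym za≡zb) a-occupied))

      agreementColouring-rainbow : RainbowKConnected (suc K) agreementColouring
      agreementColouring-rainbow = rainbowKConnected-of-separators agreementColouring λ u v u≢v →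
        vertex-separators (grid-separators (position u) (position v) (u≢v ∘ position-injective)
                                         (position-occupied u) (position-occupied v))

twoColouring-rainbowKConnected : ∀ {K n} → 1 ≤ K → ∀ R → 2 * suc K ≤ R * R → (∀ s → s < R → s * s < 2 * suc K) →
                   (ceilDiv K R + 2) * (ceilDiv K R + 2) * R ≤ n → Σ (EdgeColouring n 2) (RainbowKConnected (suc K))
twoColouring-rainbowKConnected {K} 1≤K 1 (s≤s 2K+1≤0) _ _ with () ← m+n≤o⇒n≤o K 2K+1≤0
twoColouring-rainbowKConnected {K} {n} 1≤K R@(suc (suc r)) 2[1+K]≤R² R-minimal fits =
  agreementColouring , agreementColouring-rainbow L²R≤n K≤[1+q]*r K≤q*r+q*r K≤[1+q]²+[1+q]²
  where
  open CeilingBounds K (suc r) 1≤K 2[1+K]≤R² R-minimal using (q; K≤[1+q]*r; K≤q*r+q*r; K≤[1+q]²+[1+q]²)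
  L²R≤n : (2 + q) * (2 + q) * R ≤ n
  L²R≤n = subst (λ L → L * L * R ≤ n) (+-comm q 2) fits
  open Grid n q (suc r) {{>-nonZero (<-≤-trans (s≤s z≤n) L²R≤n)}}

2≤[q+2]²R : ∀ q {R} → 0 < R → 2 ≤ (q + 2) * (q + 2) * R
2≤[q+2]²R q 0<R = *-mono-≤ (*-mono-≤ (m≤n+m 2 q) (≤-trans (s≤s z≤n) (m≤n+m 2 q))) 0<R

corollary1 : ∀ (k : ℕ) → 2 ≤ k → ∀ (n : ℕ) → f k ≤ n → RcKn≡ k n 2
corollary1 (suc K) 2≤k@(s≤s 1≤K) n f≤n with 2[1+K]≤R² , R-minimal ← ceilSqrt-spec (2 * suc K) =
  twoColouring-rainbowKConnected 1≤K (r₀ (suc K)) 2[1+K]≤R² R-minimal f≤n ,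
  rainbowKConnected⇒2≤colours 2≤k (≤-trans (2≤[q+2]²R (ceilDiv K (r₀ (suc K))) (0<R 2[1+K]≤R²)) f≤n)
  where
  0<R : ∀ {m R} → suc m ≤ R * R → 0 < R
  0<R {R = suc _} _ = s≤s z≤n
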